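{- Let $i\ge 1$. An edge $\{r,b\}\in E\setminus M_i$ with $r\in R$ and $b\in B$ is unstable relative to $M_i$ only if $b$ belongs to $C_i(r)$ and $r$ is unmatched at the end of round $i$ (i.e. $p_i(r)=\bot$).
   Context: $\mathcal{G}=(R\cup B,E)$ is a simple bipartite graph without isolated nodes (nodes in $R$ red, in $B$ blue); each node has a strict linear order (preference) on its neighbours. A matching is $M\subseteq E$ with each node in at most one edge; an edge $\{u,v\}\in E\setminus M$ is unstable relative to $M$ if each of $u,v$ is unmatched in $M$ or prefers the other to its partner in $M$. Consider the following synchronous distributed algorithm run in rounds $1,2,\dots$, each round being a blue turn followed by a red turn (messages sent in a turn are received in the next turn). Each blue $b$ keeps $p(b)$, initially $\bot$. Each red $r$ keeps a list $C(r)$, initially all neighbours of $r$ in decreasing preference, and $c(r)=\bot$, $p(r)=\bot$. Blue turn, for each $b$: let $P$ be the set of neighbours that sent `propose'; if $P=\emptyset$ do nothing; else let $Q=P\cup\{p(b)\}$ if $p(b)\ne\bot$ and $Q=P$ otherwise, let $q$ be $b$'s most preferred node in $Q$; if $q\ne p(b)$ then send `break' to $p(b)$ (if $p(b)\neq\bot$), send `accept' to $q$ and set $p(b)\gets q$; send `reject' to every $r\in P\setminus\{q\}$. Red turn, for each $r$: (1) if $c(r)\ne\bot$: receive message $m$ from $c(r)$; if $m$=`accept' set $p(r)\gets c(r)$; if $m$=`reject' remove $c(r)$ from $C(r)$; set $c(r)\gets\bot$. (2) if $p(r)\ne\bot$ and $r$ receives `break' from $p(r)$: remove $p(r)$ from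 $C(r)$ and set $p(r)\gets\bot$. (3) if $p(r)=\bot$ and $C(r)\ne\emptyset$: set $c(r)$ to the first element of $C(r)$ and send `propose' to it. A subscript $i$ denotes the value of a variable at the end of round $i$, and $M_i=\{\{r,p_i(r)\}: r\in R,\ p_i(r)\ne\bot\}$, which is a matching. -}

module Defs where

open import Data.Nat using (ℕ; zero; suc)
open import Data.Fin using (Fin; _≟_)
open import Data.Bool using (Bool; true; false; if_then_else_; _∧_; _∨_; not)
open import Data.Maybe using (Maybe; just; nothing)
open import Data.List using (List; []; _∷_; _++_; filter; allFin)
open import Data.Bool.ListAction using (any)
open import Data.Sum using (_⊎_)
open import Data.List.Membership.Propositional using (_∈_)
open import Data.List.Relation.Unary.Unique.Propositional using (Unique)
open import Data.Product using (Σ; ∃; _×_; _,_)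
open import Relation.Nullary using (¬_)
open import Relation.Nullary.Decidable using (⌊_⌋; ¬?)
open import Relation.Binary.PropositionalEquality using (_≡_; _≢_)
open import Function.Bundles using (_⇔_)

-- Preference lists: a node's preference is the list of its neighbours
-- in decreasing order of preference.  "x is preferred to y in l":
-- x occurs strictly before y.

Prefers : {A : Set} → List A → A → A → Set
Prefers {A} l x y = Σ (List A) λ xs → Σ (List A) λ ys → (l ≡ xs ++ (x ∷ ys)) × (y ∈ ys)

-- A simple bipartite graph on red nodes Fin nR and blue nodes Fin nB,
-- given by the preference lists of all nodes.  {r,b} ∈ E iff b ∈ prefR r.

record PrefGraph (nR nB : ℕ) : Set where
  field
    prefR : Fin nR → List (Fin nB)
    prefB : Fin nB → List (Fin nR)
    -- strict linear orders: no repetitions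
    uniqueR : ∀ r → Unique (prefR r)
    uniqueB : ∀ b → Unique (prefB b)
    consistent : ∀ r b → (b ∈ prefR r) ⇔ (r ∈ prefB b)
    noIsoR : ∀ r → prefR r ≢ []
    noIsoB : ∀ b → prefB b ≢ []

eqM : ∀ {n} → Maybe (Fin n) → Fin n → Bool
eqM nothing  _ = false
eqM (just x) y = ⌊ x ≟ y ⌋

firstSat : {A : Set} → List A → (A → Bool) → Maybe A
firstSat []       P = nothing
firstSat (x ∷ xs) P = if P x then just x else firstSat xs P

remove : ∀ {n} → Fin n → List (Fin n) → List (Fin n)
remove b = filter (λ x → ¬? (x ≟ b))

module Algorithm {nR nB : ℕ} (G : PrefGraph nR nB) where
  open PrefGraph G

  -- Global state at the end of a round.  `propose r b` = red r sent
  -- `propose` to blue b during the red turn (in transit to the next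
  -- blue turn).
  record State : Set where
    field
      pB      : Fin nB → Maybe (Fin nR)
      C       : Fin nR → List (Fin nB)
      c       : Fin nR → Maybe (Fin nB)
      pR      : Fin nR → Maybe (Fin nB)
      propose : Fin nR → Fin nB → Bool
  open State public

  initial : State
  initial = record
    { pB = λ _ → nothing ; C = prefR ; c = λ _ → nothing
    ; pR = λ _ → nothing ; propose = λ _ _ → false }

  record BlueOut : Set where
    field
      newPB  : Fin nB → Maybe (Fin nR)
      accept : Fin nB → Fin nR → Bool
      reject : Fin nB → Fin nR → Bool
      brk    : Fin nB → Fin nR → Bool

  blueTurn : State → BlueOut
  blueTurn s = record { newPB = newPB ; accept = acc ; reject = rej ; brk = brk }
    where
    nonEmpty : Fin nB → Bool
    nonEmpty b = any (λ r → propose s r b) (allFin nR)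
    -- membership in Q = P ∪ {p(b)}
    inQ : Fin nB → Fin nR → Bool
    inQ b r = propose s r b ∨ eqM (pB s b) r
    -- q = most preferred node of Q (only meaningful when P ≠ ∅)
    q : Fin nB → Maybe (Fin nR)
    q b = if nonEmpty b then firstSat (prefB b) (inQ b) else nothing
    chg : Fin nB → Maybe (Fin nR) → Bool
    chg b nothing   = false
    chg b (just q') = not (eqM (pB s b) q')
    change : Fin nB → Bool
    change b = chg b (q b)
    newPB : Fin nB → Maybe (Fin nR)
    newPB b = if change b then q b else pB s b
    acc : Fin nB → Fin nR → Bool
    acc b r = change b ∧ eqM (q b) r
    brk : Fin nB → Fin nR → Bool
    brk b r = change b ∧ eqM (pB s b) r
    rej : Fin nB → Fin nR → Bool
    rej b r = propose s r b ∧ not (eqM (q b) r)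

  record RedLocal : Set where
    constructor red
    field
      lC : List (Fin nB)
      lc : Maybe (Fin nB)
      lp : Maybe (Fin nB)

  step1 : Fin nR → BlueOut → RedLocal → RedLocal
  step1 r o (red C nothing p)  = red C nothing p
  step1 r o (red C (just b) p) =
    red (if BlueOut.reject o b r then remove b C else C) nothing
        (if BlueOut.accept o b r then just b else p)

  step2 : Fin nR → BlueOut → RedLocal → RedLocal
  step2 r o (red C c nothing)  = red C c nothing
  step2 r o (red C c (just b)) =
    if BlueOut.brk o b r then red (remove b C) c nothing else red C c (just b)

  step3 : RedLocal → RedLocal
  step3 (red (b ∷ C) c nothing) = red (b ∷ C) (just b) nothing
  step3 l = l

  sent3 : RedLocal → Fin nB → Bool
  sent3 (red (b ∷ C) c nothing) b' = ⌊ b ≟ b' ⌋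
  sent3 l b' = false

  redAfter12 : State → BlueOut → Fin nR → RedLocal
  redAfter12 s o r = step2 r o (step1 r o (red (C s r) (c s r) (pR s r)))

  round : State → State
  round s = record
    { pB = BlueOut.newPB o
    ; C = λ r → RedLocal.lC (step3 (redAfter12 s o r))
    ; c = λ r → RedLocal.lc (step3 (redAfter12 s o r))
    ; pR = λ r → RedLocal.lp (step3 (redAfter12 s o r))
    ; propose = λ r → sent3 (redAfter12 s o r) }
    where o = blueTurn s

  -- state at the end of round i (round 0 = initial state)
  run : ℕ → State
  run zero    = initial
  run (suc i) = round (run i)

  InM : ℕ → Fin nR → Fin nB → Set
  InM i r b = pR (run i) r ≡ just b

  Unstable : ℕ → Fin nR → Fin nB → Set
  Unstable i r b =
    (b ∈ prefR r) × ¬ InM i r b ×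
    ((∀ b' → ¬ InM i r b') ⊎ (∃ λ b' → InM i r b' × Prefers (prefR r) b b')) ×
    ((∀ r' → ¬ InM i r' b) ⊎ (∃ λ r' → InM i r' b × Prefers (prefB b) r r'))

module Submission where

-- The proof is an invariant argument: every reachable state satisfies the
-- invariants collected in the record Inv below, the two decisive ones being
--   * blocked:    if b is a neighbour of r that r has crossed off its list
--                 C(r), then b is matched to someone b strictly prefers to r;
--   * dominance:  if r is matched to (or proposing to) b, then r weakly
--                 prefers b to every node still in C(r).
-- Given these, an unstable edge {r,b} cannot have b ∉ C(r) (b would not
-- prefer r to its partner), and then r cannot be matched (r would not prefer
-- b to its partner).

open import Defs
open import Data.Nat using (ℕ; suc)
open import Data.Fin using (Fin)
open import Data.Maybe using (nothing)
open import Data.List.Membership.Propositional using (_∈_)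
open import Data.Product using (_×_)
open import Relation.Binary.PropositionalEquality using (_≡_)

open import Data.Nat using (zero; _≤_; _<_; z≤n; s≤s)
open import Data.Nat.Properties using (≤-refl; <⇒≤; suc-injective; 0≢1+n; ≤∧≢⇒<; ≤-<-trans; <-asym; <⇒≱)
open import Data.Bool using (Bool; true; false; _∨_; not; if_then_else_)
open import Data.Bool.Properties using (∧-conicalˡ; ∧-conicalʳ; ∨-zeroʳ; ∨-identityʳ; not-injective; ¬-not)
open import Data.Bool.ListAction using (any)
open import Data.Maybe using (Maybe; just)
open import Data.Maybe.Properties using (just-injective)
open import Data.Fin using (_≟_)
open import Data.List using (List; []; _∷_; _++_; allFin)
open import Data.List.Membership.Propositional using (_∉_)
open import Data.List.Membership.Propositional.Properties using (∈-filter⁺; ∈-allFin; ∈-++⁺ʳ)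
open import Data.List.Relation.Unary.Any using (here; there)
open import Data.List.Relation.Unary.All as All using (All; []; _∷_)
import Data.List.Relation.Unary.All.Properties as AllProp
open import Data.List.Relation.Unary.AllPairs as AllPairs using (AllPairs; []; _∷_)
import Data.List.Relation.Unary.AllPairs.Properties as AllPairsProp
open import Data.List.Relation.Unary.Unique.Propositional using (Unique)
open import Data.Product using (∃; _,_; proj₁; proj₂)
open import Data.Sum using (_⊎_; inj₁; inj₂; [_,_])
open import Data.Empty using (⊥; ⊥-elim)
open import Function using (id; _∘_)
open import Function.Bundles using (Equivalence)
open import Relation.Nullary using (¬_; yes; no; contradiction)
open import Relation.Nullary.Decidable using (¬?)
open import Relation.Binary.PropositionalEquality using (_≢_; refl; sym; trans; subst)

true≢false : ∀ {x : Bool} → x ≡ true → x ≡ false → ⊥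
true≢false refl ()

separated-by : ∀ {A : Set} (P : A → Bool) {x z} → P x ≡ false → P z ≡ true → x ≢ z
separated-by P Px Pz refl = true≢false Pz Px

no-just⇒nothing : ∀ {A : Set} {m : Maybe A} → (∀ x → m ≢ just x) → m ≡ nothing
no-just⇒nothing {m = nothing} _ = refl
no-just⇒nothing {m = just x}  f = contradiction refl (f x)

any-true : ∀ {A : Set} (f : A → Bool) {x} {xs : List A} → x ∈ xs → f x ≡ true → any f xs ≡ true
any-true f (here refl) fx rewrite fx = refl
any-true f {xs = y ∷ ys} (there x∈) fx rewrite any-true f x∈ fx = ∨-zeroʳ (f y)

eqM-refl : ∀ {n} (x : Fin n) → eqM (just x) x ≡ true
eqM-refl x with x ≟ x
... | yes _ = refl
... | no x≢x = contradiction refl x≢x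

eqM-sound : ∀ {n} {m : Maybe (Fin n)} {x} → eqM m x ≡ true → m ≡ just x
eqM-sound {m = just y} {x} e with y ≟ x
... | yes refl = refl

eqM-just : ∀ {n} {m : Maybe (Fin n)} {x} → m ≡ just x → eqM m x ≡ true
eqM-just {x = x} refl = eqM-refl x

eqM-false : ∀ {n} {m : Maybe (Fin n)} {x} → eqM m x ≡ false → m ≢ just x
eqM-false {x = x} e refl = true≢false (eqM-refl x) e

eqM-complete : ∀ {n} {m : Maybe (Fin n)} {x} → m ≢ just x → eqM m x ≡ false
eqM-complete {m = m} {x} m≢x = ¬-not (m≢x ∘ eqM-sound)

removed-is : ∀ {n} {x y : Fin n} {xs} → y ∈ xs → y ∉ remove x xs → y ≡ x
removed-is {x = x} {y} y∈ y∉ with y ≟ x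
... | yes y≡x = y≡x
... | no y≢x = contradiction (∈-filter⁺ (λ z → ¬? (z ≟ x)) y∈ y≢x) y∉

data Shrinks {n} (xs : List (Fin n)) : List (Fin n) → Set where
  unchanged : Shrinks xs xs
  removing  : ∀ y → Shrinks xs (remove y xs)

shrinks-All : ∀ {n} {P : Fin n → Set} {xs ys} → Shrinks xs ys → All P xs → All P ys
shrinks-All unchanged     all = all
shrinks-All (removing y) all = AllProp.filter⁺ (λ z → ¬? (z ≟ y)) all

shrinks-AllPairs : ∀ {n} {R : Fin n → Fin n → Set} {xs ys} → Shrinks xs ys → AllPairs R xs → AllPairs R ys
shrinks-AllPairs unchanged     all = all
shrinks-AllPairs (removing y) all = AllPairsProp.filter⁺ (λ z → ¬? (z ≟ y)) all

-- The rank of y in a preference list l is its position (the length of l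
-- if y does not occur); a smaller rank means a more preferred node.
rank : ∀ {n} → List (Fin n) → Fin n → ℕ
rank []       y = 0
rank (x ∷ xs) y with x ≟ y
... | yes _ = 0
... | no _  = suc (rank xs y)

rank-head : ∀ {n} (x : Fin n) xs → rank (x ∷ xs) x ≡ 0
rank-head x xs with x ≟ x
... | yes _ = refl
... | no x≢x = contradiction refl x≢x

rank-tail : ∀ {n} {x y : Fin n} xs → x ≢ y → rank (x ∷ xs) y ≡ suc (rank xs y)
rank-tail {x = x} {y} xs x≢y with x ≟ y
... | yes x≡y = contradiction x≡y x≢y
... | no _ = refl

rank-injective : ∀ {n} {l : List (Fin n)} {x y} → x ∈ l → rank l x ≡ rank l y → x ≡ y
rank-injective {l = z ∷ zs} {x} {y} x∈ e with z ≟ x | z ≟ y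
... | yes z≡x | yes z≡y = trans (sym z≡x) z≡y
... | yes _   | no _    = contradiction e 0≢1+n
... | no _    | yes _   = contradiction (sym e) 0≢1+n
... | no z≢x  | no _ with x∈
...   | here x≡z   = contradiction (sym x≡z) z≢x
...   | there x∈zs = rank-injective x∈zs (suc-injective e)

Prefers⇒rank< : ∀ {n} {l : List (Fin n)} {x y} → Unique l → Prefers l x y → rank l x < rank l y
Prefers⇒rank< {x = x} (x∉ys ∷ _) ([] , ys , refl , y∈ys)
  rewrite rank-head x ys | rank-tail ys (All.lookup x∉ys y∈ys) = s≤s z≤n
Prefers⇒rank< {x = x} (z∉ ∷ u) (z ∷ zs , ys , refl , y∈ys)
  rewrite rank-tail (zs ++ x ∷ ys) (All.lookup z∉ (∈-++⁺ʳ zs (here refl)))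
        | rank-tail (zs ++ x ∷ ys) (All.lookup z∉ (∈-++⁺ʳ zs (there y∈ys)))
  = s≤s (Prefers⇒rank< u (zs , ys , refl , y∈ys))

Ascending : ∀ {n} → List (Fin n) → List (Fin n) → Set
Ascending l = AllPairs (λ x y → rank l x < rank l y)

prefers-ordered : ∀ {A : Set} (l : List A) → AllPairs (Prefers l) l
prefers-ordered []       = []
prefers-ordered (x ∷ xs) = All.tabulate (λ y∈ → [] , xs , refl , y∈) ∷ AllPairs.map later (prefers-ordered xs)
  where
  later : ∀ {y z} → Prefers xs y z → Prefers (x ∷ xs) y z
  later (ys , zs , refl , z∈) = x ∷ ys , zs , refl , z∈

unique⇒ascending : ∀ {n} {l : List (Fin n)} → Unique l → Ascending l l
unique⇒ascending {l = l} u = AllPairs.map (Prefers⇒rank< u) (prefers-ordered l)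

head-least : ∀ {n} {l : List (Fin n)} {h t} → Ascending l (h ∷ t) → All (λ y → rank l h ≤ rank l y) (h ∷ t)
head-least (h<t ∷ _) = ≤-refl ∷ All.map <⇒≤ h<t

firstSat-sound : ∀ {A : Set} {P : A → Bool} (l : List A) {q} → firstSat l P ≡ just q → q ∈ l × P q ≡ true
firstSat-sound {P = P} (x ∷ xs) e with P x in Px
firstSat-sound (x ∷ xs) refl | true = here refl , Px
firstSat-sound (x ∷ xs) e    | false = let q∈ , Pq = firstSat-sound xs e in there q∈ , Pq

firstSat-complete : ∀ {A : Set} {P : A → Bool} {l : List A} {y} → y ∈ l → P y ≡ true → ∃ λ q → firstSat l P ≡ just q
firstSat-complete {P = P} {x ∷ xs} y∈ Py with P x in Px
... | true = x , refl
firstSat-complete (here refl) Py | false = ⊥-elim (true≢false Py Px)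
firstSat-complete (there y∈) Py  | false = firstSat-complete y∈ Py

firstSat-least : ∀ {n} {P : Fin n → Bool} (l : List (Fin n)) {q y} →
  firstSat l P ≡ just q → y ∈ l → P y ≡ true → rank l q ≤ rank l y
firstSat-least {P = P} (x ∷ xs) e y∈ Py with P x in Px
firstSat-least (x ∷ xs) refl y∈ Py | true rewrite rank-head x xs = z≤n
firstSat-least (x ∷ xs) e (here refl) Py | false = ⊥-elim (true≢false Py Px)
firstSat-least {P = P} (x ∷ xs) e (there y∈) Py | false
  rewrite rank-tail xs (separated-by P Px (proj₂ (firstSat-sound xs e))) | rank-tail xs (separated-by P Px Py)
  = s≤s (firstSat-least xs e y∈ Py)

module BlueTurn {nR nB} (G : PrefGraph nR nB) where
  open PrefGraph G
  open Algorithm G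

  newPartner : State → Fin nB → Maybe (Fin nR)
  newPartner s = BlueOut.newPB (blueTurn s)

  accepts breaks rejects : State → Fin nB → Fin nR → Bool
  accepts s = BlueOut.accept (blueTurn s)
  breaks  s = BlueOut.brk (blueTurn s)
  rejects s = BlueOut.reject (blueTurn s)

  rankᴮ : Fin nB → Fin nR → ℕ
  rankᴮ b = rank (prefB b)

  inQ : State → Fin nB → Fin nR → Bool
  inQ s b r = propose s r b ∨ eqM (pB s b) r

  choice : State → Fin nB → Maybe (Fin nR)
  choice s b = if any (λ r → propose s r b) (allFin nR) then firstSat (prefB b) (inQ s b) else nothing

  proposer-inQ : ∀ s b {r} → propose s r b ≡ true → inQ s b r ≡ true
  proposer-inQ s b p rewrite p = refl

  partner-inQ : ∀ s b {r} → pB s b ≡ just r → inQ s b r ≡ true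
  partner-inQ s b {r} p rewrite eqM-just p = ∨-zeroʳ (propose s r b)

  inQ-proposer : ∀ s b {r} → inQ s b r ≡ true → pB s b ≢ just r → propose s r b ≡ true
  inQ-proposer s b {r} e p≢r =
    trans (sym (∨-identityʳ (propose s r b))) (subst (λ x → propose s r b ∨ x ≡ true) (eqM-complete p≢r) e)

  choice-after-proposal : ∀ s b {r} → propose s r b ≡ true → choice s b ≡ firstSat (prefB b) (inQ s b)
  choice-after-proposal s b {r} p rewrite any-true (λ r' → propose s r' b) (∈-allFin r) p = refl

  choice-found : ∀ s b {q} → choice s b ≡ just q → firstSat (prefB b) (inQ s b) ≡ just q
  choice-found s b e  with any (λ r → propose s r b) (allFin nR)
  choice-found s b e  | true  = e
  choice-found s b () | false

  Unchanged : State → Fin nB → Set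
  Unchanged s b = newPartner s b ≡ pB s b × (∀ r → accepts s b r ≡ false) × (∀ r → breaks s b r ≡ false)

  unchanged-without-choice : ∀ s b → choice s b ≡ nothing → Unchanged s b
  unchanged-without-choice s b e rewrite e = refl , (λ _ → refl) , (λ _ → refl)

  unchanged-if-partner-chosen : ∀ s b {q} → choice s b ≡ just q → eqM (pB s b) q ≡ true → Unchanged s b
  unchanged-if-partner-chosen s b e same rewrite e | same = refl , (λ _ → refl) , (λ _ → refl)

  switch-to-choice : ∀ s b {q} → choice s b ≡ just q → eqM (pB s b) q ≡ false →
    newPartner s b ≡ just q × (∀ r → accepts s b r ≡ eqM (just q) r) × (∀ r → breaks s b r ≡ eqM (pB s b) r)
  switch-to-choice s b e new rewrite e | new = refl , (λ _ → refl) , (λ _ → refl)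

  rejected : ∀ s b r → rejects s b r ≡ true → propose s r b ≡ true × eqM (choice s b) r ≡ false
  rejected s b r e =
    ∧-conicalˡ (propose s r b) (not (eqM (choice s b) r)) e ,
    not-injective {y = false} (∧-conicalʳ (propose s r b) (not (eqM (choice s b) r)) e)

  record Best (s : State) (b : Fin nB) (q : Fin nR) : Set where
    field
      listed : q ∈ prefB b
      chosen : inQ s b q ≡ true
      least  : ∀ {r} → r ∈ prefB b → inQ s b r ≡ true → rankᴮ b q ≤ rankᴮ b r

  data Move (s : State) (b : Fin nB) (q : Fin nR) : Set where
    stays    : pB s b ≡ just q → Unchanged s b → Move s b q
    switches : pB s b ≢ just q → newPartner s b ≡ just q →
               (∀ r → accepts s b r ≡ eqM (just q) r) → (∀ r → breaks s b r ≡ eqM (pB s b) r) → Move s b q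

  data Outcome (s : State) (b : Fin nB) : Set where
    idle    : Unchanged s b → (∀ {r} → rejects s b r ≡ true → r ∉ prefB b) → Outcome s b
    chooses : ∀ q → Best s b q → (∀ {r} → rejects s b r ≡ true → q ≢ r) → Move s b q → Outcome s b

  outcome : ∀ s b → Outcome s b
  outcome s b with choice s b in e
  ... | nothing = idle (unchanged-without-choice s b e) rejectsUnlisted
    where
    rejectsUnlisted : ∀ {r} → rejects s b r ≡ true → r ∉ prefB b
    rejectsUnlisted {r} j r∈ with proposed ← proj₁ (rejected s b r j)
                            with firstSat-complete r∈ (proposer-inQ s b proposed)
    ... | q , found with () ← trans (sym e) (trans (choice-after-proposal s b proposed) found)
  ... | just q = chooses q best rejectsOthers move
    where
    found : firstSat (prefB b) (inQ s b) ≡ just q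
    found = choice-found s b e

    best : Best s b q
    best = record { listed = proj₁ (firstSat-sound (prefB b) found)
                  ; chosen = proj₂ (firstSat-sound (prefB b) found)
                  ; least  = firstSat-least (prefB b) found }

    rejectsOthers : ∀ {r} → rejects s b r ≡ true → q ≢ r
    rejectsOthers {r} j refl = eqM-false (proj₂ (rejected s b r j)) e

    move : Move s b q
    move with eqM (pB s b) q in same
    ... | true  = stays (eqM-sound same) (unchanged-if-partner-chosen s b e same)
    ... | false = let new , acc , brk = switch-to-choice s b e same in switches (eqM-false same) new acc brk

  Outranked : Fin nB → Maybe (Fin nR) → Fin nR → Set
  Outranked b m r = ∃ λ r' → m ≡ just r' × rankᴮ b r' < rankᴮ b r

  moved-to : ∀ {s b q} → Move s b q → newPartner s b ≡ just q
  moved-to (stays p (kept , _ , _)) = trans kept p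
  moved-to (switches _ new _ _)     = new

  choice-outranks : ∀ {s b q r} → Best s b q → Move s b q → r ∈ prefB b → inQ s b r ≡ true → q ≢ r →
    Outranked b (newPartner s b) r
  choice-outranks best m r∈ r∈Q q≢r = _ , moved-to m , ≤∧≢⇒< (least r∈ r∈Q) (q≢r ∘ rank-injective listed)
    where open Best best

  newPartner-listed : ∀ s b {r} → newPartner s b ≡ just r → pB s b ≡ just r ⊎ r ∈ prefB b
  newPartner-listed s b e with outcome s b
  ... | idle (kept , _ , _) _ = inj₁ (trans (sym kept) e)
  ... | chooses q best _ m with refl ← just-injective (trans (sym (moved-to m)) e) = inj₂ (Best.listed best)

  outranked-persists : ∀ s b {r₀ r} → pB s b ≡ just r₀ → r₀ ∈ prefB b → rankᴮ b r₀ < rankᴮ b r →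
    Outranked b (newPartner s b) r
  outranked-persists s b {r₀} p r₀∈ lt with outcome s b
  ... | idle (kept , _ , _) _ = r₀ , trans kept p , lt
  ... | chooses q best _ m    = q , moved-to m , ≤-<-trans (Best.least best r₀∈ (partner-inQ s b p)) lt

  break-from-partner : ∀ s b {r} → breaks s b r ≡ true → pB s b ≡ just r
  break-from-partner s b {r} k with outcome s b
  ... | idle (_ , _ , noBreak) _                    = ⊥-elim (true≢false k (noBreak r))
  ... | chooses _ _ _ (stays _ (_ , _ , noBreak))   = ⊥-elim (true≢false k (noBreak r))
  ... | chooses _ _ _ (switches _ _ _ brk)          = eqM-sound (trans (sym (brk r)) k)

  break-outranks : ∀ s b {r} → breaks s b r ≡ true → r ∈ prefB b → Outranked b (newPartner s b) r
  break-outranks s b {r} k r∈ with break-from-partner s b k | outcome s b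
  ... | _ | idle (_ , _ , noBreak) _                  = ⊥-elim (true≢false k (noBreak r))
  ... | _ | chooses _ _ _ (stays _ (_ , _ , noBreak)) = ⊥-elim (true≢false k (noBreak r))
  ... | p | chooses q best _ m@(switches p≢q _ _ _)   =
    choice-outranks best m r∈ (partner-inQ s b p) λ { refl → p≢q p }

  reject-outranks : ∀ s b {r} → rejects s b r ≡ true → r ∈ prefB b → Outranked b (newPartner s b) r
  reject-outranks s b {r} j r∈ with outcome s b
  ... | idle _ rejectsUnlisted = contradiction r∈ (rejectsUnlisted j)
  ... | chooses q best others m =
    choice-outranks best m r∈ (proposer-inQ s b (proj₁ (rejected s b r j))) (others j)

  accept-chosen : ∀ s b {r} → accepts s b r ≡ true → newPartner s b ≡ just r × propose s r b ≡ true
  accept-chosen s b {r} a with outcome s b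
  ... | idle (_ , noAccept , _) _                  = ⊥-elim (true≢false a (noAccept r))
  ... | chooses _ _ _ (stays _ (_ , noAccept , _)) = ⊥-elim (true≢false a (noAccept r))
  ... | chooses q best _ (switches p≢q new acc _)
    with refl ← just-injective (eqM-sound (trans (sym (acc r)) a)) = new , inQ-proposer s b (Best.chosen best) p≢q

  accept-not-reject : ∀ s b {r} → accepts s b r ≡ true → rejects s b r ≡ false
  accept-not-reject s b {r} a with outcome s b
  ... | idle (_ , noAccept , _) _                  = ⊥-elim (true≢false a (noAccept r))
  ... | chooses _ _ _ (stays _ (_ , noAccept , _)) = ⊥-elim (true≢false a (noAccept r))
  ... | chooses q _ others (switches _ _ acc _)    =
    ¬-not λ j → others j (just-injective (eqM-sound (trans (sym (acc r)) a)))

  newPartner-source : ∀ s b {r} → newPartner s b ≡ just r → accepts s b r ≡ true ⊎ (pB s b ≡ just r × breaks s b r ≡ false)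
  newPartner-source s b {r} e with outcome s b
  ... | idle (kept , _ , noBreak) _                  = inj₂ (trans (sym kept) e , noBreak r)
  ... | chooses _ _ _ (stays _ (kept , _ , noBreak)) = inj₂ (trans (sym kept) e , noBreak r)
  ... | chooses q _ _ (switches _ new acc _)
    with refl ← just-injective (trans (sym new) e) = inj₁ (trans (acc q) (eqM-refl q))

  partner-kept : ∀ s b {r} → pB s b ≡ just r → breaks s b r ≡ false → newPartner s b ≡ just r
  partner-kept s b {r} p k with outcome s b
  ... | idle (kept , _ , _) _                  = trans kept p
  ... | chooses _ _ _ (stays _ (kept , _ , _)) = trans kept p
  ... | chooses _ _ _ (switches _ _ _ brk)     = ⊥-elim (true≢false (trans (brk r) (eqM-just p)) k)

module RedTurn {nR nB} (G : PrefGraph nR nB) where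
  open Algorithm G
  open RedLocal

  data Reaction (o : BlueOut) (r : Fin nR) : RedLocal → RedLocal → Set where
    idle     : ∀ {cs} → Reaction o r (red cs nothing nothing) (red cs nothing nothing)
    kept     : ∀ {cs b} → BlueOut.brk o b r ≡ false →
               Reaction o r (red cs nothing (just b)) (red cs nothing (just b))
    dumped   : ∀ {cs b} → BlueOut.brk o b r ≡ true →
               Reaction o r (red cs nothing (just b)) (red (remove b cs) nothing nothing)
    accepted : ∀ {cs b} → BlueOut.accept o b r ≡ true →
               Reaction o r (red cs (just b) nothing) (red cs nothing (just b))
    rejected : ∀ {cs b} → BlueOut.accept o b r ≡ false → BlueOut.reject o b r ≡ true →
               Reaction o r (red cs (just b) nothing) (red (remove b cs) nothing nothing)
    ignored  : ∀ {cs b} → BlueOut.accept o b r ≡ false → BlueOut.reject o b r ≡ false →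
               Reaction o r (red cs (just b) nothing) (red cs nothing nothing)

  reacts : ∀ o r l →
    (∀ {b} → lc l ≡ just b → lp l ≡ nothing) →
    (∀ {b} → lc l ≡ just b → BlueOut.brk o b r ≡ false) →
    (∀ {b} → BlueOut.accept o b r ≡ true → BlueOut.reject o b r ≡ false) →
    Reaction o r l (step2 r o (step1 r o l))
  reacts o r (red cs nothing nothing) _ _ _ = idle
  reacts o r (red cs nothing (just b)) _ _ _ with BlueOut.brk o b r in k
  ... | true  = dumped k
  ... | false = kept k
  reacts o r (red cs (just b) (just _)) free _ _ with () ← free refl
  reacts o r (red cs (just b) nothing) _ noBreak exclusive
    with BlueOut.accept o b r in a | BlueOut.reject o b r in j
  ... | true  | true  = ⊥-elim (true≢false j (exclusive a))
  ... | true  | false rewrite noBreak refl = accepted a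
  ... | false | true  = rejected a j
  ... | false | false = ignored a j

  reaction-shrinks : ∀ {o r l l'} → Reaction o r l l' → Shrinks (lC l) (lC l')
  reaction-shrinks idle           = unchanged
  reaction-shrinks (kept _)       = unchanged
  reaction-shrinks (dumped _)     = removing _
  reaction-shrinks (accepted _)   = unchanged
  reaction-shrinks (rejected _ _) = removing _
  reaction-shrinks (ignored _ _)  = unchanged

  reaction-settled : ∀ {o r l l'} → Reaction o r l l' → lc l' ≡ nothing
  reaction-settled idle           = refl
  reaction-settled (kept _)       = refl
  reaction-settled (dumped _)     = refl
  reaction-settled (accepted _)   = refl
  reaction-settled (rejected _ _) = refl
  reaction-settled (ignored _ _)  = refl

  reaction-partner : ∀ {o r l l' b} → Reaction o r l l' → lp l' ≡ just b →
    (lc l ≡ just b × BlueOut.accept o b r ≡ true) ⊎ (lp l ≡ just b × BlueOut.brk o b r ≡ false)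
  reaction-partner (kept k)       refl = inj₂ (refl , k)
  reaction-partner (accepted a)   refl = inj₁ (refl , a)
  reaction-partner idle           ()
  reaction-partner (dumped _)     ()
  reaction-partner (rejected _ _) ()
  reaction-partner (ignored _ _)  ()

  reaction-accepts : ∀ {o r l l' b} → Reaction o r l l' → lc l ≡ just b → BlueOut.accept o b r ≡ true → lp l' ≡ just b
  reaction-accepts (accepted _)   refl _  = refl
  reaction-accepts (rejected a _) refl a' = ⊥-elim (true≢false a' a)
  reaction-accepts (ignored a _)  refl a' = ⊥-elim (true≢false a' a)
  reaction-accepts idle           ()
  reaction-accepts (kept _)       ()
  reaction-accepts (dumped _)     ()

  reaction-keeps : ∀ {o r l l' b} → Reaction o r l l' → lp l ≡ just b → BlueOut.brk o b r ≡ false → lp l' ≡ just b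
  reaction-keeps (kept _)       refl _  = refl
  reaction-keeps (dumped k)     refl k' = ⊥-elim (true≢false k k')
  reaction-keeps idle           ()
  reaction-keeps (accepted _)   ()
  reaction-keeps (rejected _ _) ()
  reaction-keeps (ignored _ _)  ()

  reaction-drops : ∀ {o r l l' y} → Reaction o r l l' → y ∈ lC l → y ∉ lC l' →
    (lc l ≡ just y × BlueOut.reject o y r ≡ true) ⊎ (lp l ≡ just y × BlueOut.brk o y r ≡ true)
  reaction-drops (dumped k)     y∈ y∉ with refl ← removed-is y∈ y∉ = inj₂ (refl , k)
  reaction-drops (rejected _ j) y∈ y∉ with refl ← removed-is y∈ y∉ = inj₁ (refl , j)
  reaction-drops idle           y∈ y∉ = contradiction y∈ y∉
  reaction-drops (kept _)       y∈ y∉ = contradiction y∈ y∉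
  reaction-drops (accepted _)   y∈ y∉ = contradiction y∈ y∉
  reaction-drops (ignored _ _)  y∈ y∉ = contradiction y∈ y∉

  step3-C : ∀ l → lC (step3 l) ≡ lC l
  step3-C (red []      _ _)        = refl
  step3-C (red (_ ∷ _) _ nothing)  = refl
  step3-C (red (_ ∷ _) _ (just _)) = refl

  step3-p : ∀ l → lp (step3 l) ≡ lp l
  step3-p (red []      _ _)        = refl
  step3-p (red (_ ∷ _) _ nothing)  = refl
  step3-p (red (_ ∷ _) _ (just _)) = refl

  step3-proposes : ∀ l {h} → lc l ≡ nothing → lc (step3 l) ≡ just h → lp l ≡ nothing × ∃ λ t → lC l ≡ h ∷ t
  step3-proposes (red []       _ _)        refl ()
  step3-proposes (red (_ ∷ cs) _ nothing)  refl refl = refl , cs , refl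
  step3-proposes (red (_ ∷ _)  _ (just _)) refl ()

  step3-sent : ∀ l {b} → sent3 l b ≡ true → lc (step3 l) ≡ just b
  step3-sent (red []      _ _)        ()
  step3-sent (red (x ∷ _) _ nothing)  e = eqM-sound {m = just x} e
  step3-sent (red (_ ∷ _) _ (just _)) ()

module Invariants {nR nB} (G : PrefGraph nR nB) where
  open PrefGraph G
  open Algorithm G
  open BlueTurn G
  open RedTurn G
  open import Data.List.Membership.DecPropositional (_≟_ {nB}) using (_∈?_)

  rankᴿ : Fin nR → Fin nB → ℕ
  rankᴿ r = rank (prefR r)

  Dominates : Fin nR → Fin nB → List (Fin nB) → Set
  Dominates r b = All (λ y → rankᴿ r b ≤ rankᴿ r y)

  neighbours-symmetric : ∀ {r b} → b ∈ prefR r → r ∈ prefB b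
  neighbours-symmetric {r} {b} = Equivalence.to (consistent r b)

  record Inv (s : State) : Set where
    field
      partnerᴿ          : ∀ {r b} → pR s r ≡ just b → pB s b ≡ just r
      partnerᴮ          : ∀ {r b} → pB s b ≡ just r → pR s r ≡ just b
      proposalTo        : ∀ {r b} → propose s r b ≡ true → c s r ≡ just b
      proposerFree      : ∀ {r b} → c s r ≡ just b → pR s r ≡ nothing
      ascending         : ∀ r → Ascending (prefR r) (C s r)
      partnerDominates  : ∀ {r b} → pR s r ≡ just b → Dominates r b (C s r)
      proposeeDominates : ∀ {r b} → c s r ≡ just b → Dominates r b (C s r)
      blocked           : ∀ {r b} → b ∈ prefR r → b ∉ C s r → Outranked b (pB s b) r
      partnerListed     : ∀ {r b} → pB s b ≡ just r → r ∈ prefB b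

  initial-Inv : Inv initial
  initial-Inv = record
    { partnerᴿ = λ () ; partnerᴮ = λ () ; proposalTo = λ () ; proposerFree = λ ()
    ; ascending = λ r → unique⇒ascending (uniqueR r)
    ; partnerDominates = λ () ; proposeeDominates = λ ()
    ; blocked = λ b∈ b∉ → contradiction b∈ b∉
    ; partnerListed = λ () }

  module Round (s : State) (I : Inv s) where
    open Inv I

    o : BlueOut
    o = blueTurn s

    s' : State
    s' = round s

    before after : Fin nR → RedLocal
    before r = red (C s r) (c s r) (pR s r)
    after  r = redAfter12 s o r

    -- a break goes to a partner, and partners do not propose
    noBreakToProposee : ∀ {r b} → c s r ≡ just b → breaks s b r ≡ false
    noBreakToProposee {r} {b} cr = ¬-not λ k →
      contradiction (trans (sym (partnerᴮ (break-from-partner s b k))) (proposerFree cr)) λ ()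

    react : ∀ r → Reaction o r (before r) (after r)
    react r = reacts o r (before r) proposerFree noBreakToProposee (λ {b} → accept-not-reject s b)

    newC : ∀ r → C s' r ≡ RedLocal.lC (after r)
    newC r = step3-C (after r)

    newP : ∀ r → pR s' r ≡ RedLocal.lp (after r)
    newP r = step3-p (after r)

    partnerᴿ' : ∀ {r b} → pR s' r ≡ just b → pB s' b ≡ just r
    partnerᴿ' {r} {b} e with reaction-partner (react r) (trans (sym (newP r)) e)
    ... | inj₁ (_ , a) = proj₁ (accept-chosen s b a)
    ... | inj₂ (p , k) = partner-kept s b (partnerᴿ p) k

    partnerᴮ' : ∀ {r b} → pB s' b ≡ just r → pR s' r ≡ just b
    partnerᴮ' {r} {b} e = trans (newP r) (newRedPartner (newPartner-source s b e))
      where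
      newRedPartner : accepts s b r ≡ true ⊎ (pB s b ≡ just r × breaks s b r ≡ false) → RedLocal.lp (after r) ≡ just b
      newRedPartner (inj₁ a)       = reaction-accepts (react r) (proposalTo (proj₂ (accept-chosen s b a))) a
      newRedPartner (inj₂ (p , k)) = reaction-keeps (react r) (partnerᴮ p) k

    proposalTo' : ∀ {r b} → propose s' r b ≡ true → c s' r ≡ just b
    proposalTo' {r} = step3-sent (after r)

    proposerFree' : ∀ {r b} → c s' r ≡ just b → pR s' r ≡ nothing
    proposerFree' {r} e = trans (newP r) (proj₁ (step3-proposes (after r) (reaction-settled (react r)) e))

    ascending' : ∀ r → Ascending (prefR r) (C s' r)
    ascending' r rewrite newC r = shrinks-AllPairs (reaction-shrinks (react r)) (ascending r)

    -- a new partner was the proposee or the old partner, and C(r) only shrinks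
    partnerDominates' : ∀ {r b} → pR s' r ≡ just b → Dominates r b (C s' r)
    partnerDominates' {r} e rewrite newC r with reaction-partner (react r) (trans (sym (newP r)) e)
    ... | inj₁ (cr , _) = shrinks-All (reaction-shrinks (react r)) (proposeeDominates cr)
    ... | inj₂ (pr , _) = shrinks-All (reaction-shrinks (react r)) (partnerDominates pr)

    -- a new proposee is the head of the ascending list C(r)
    proposeeDominates' : ∀ {r b} → c s' r ≡ just b → Dominates r b (C s' r)
    proposeeDominates' {r} {b} e with step3-proposes (after r) (reaction-settled (react r)) e
    ... | _ , t , headed = subst (Dominates r b) (sym C≡b∷t) (head-least {l = prefR r} (subst (Ascending (prefR r)) C≡b∷t (ascending' r)))
      where
      C≡b∷t : C s' r ≡ b ∷ t
      C≡b∷t = trans (newC r) headed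

    -- b leaves C(r) by rejecting r or breaking up with r, and then holds someone
    -- better; an earlier better partner is only ever improved upon
    blocked' : ∀ {r b} → b ∈ prefR r → b ∉ C s' r → Outranked b (pB s' b) r
    blocked' {r} {b} b∈ b∉' with b ∈? C s r
    ... | no b∉ with r₀ , p , lt ← blocked b∈ b∉ = outranked-persists s b p (partnerListed p) lt
    ... | yes b∈C with reaction-drops (react r) b∈C (b∉' ∘ subst (b ∈_) (sym (newC r)))
    ...   | inj₁ (_ , j) = reject-outranks s b j (neighbours-symmetric b∈)
    ...   | inj₂ (_ , k) = break-outranks s b k (neighbours-symmetric b∈)

    partnerListed' : ∀ {r b} → pB s' b ≡ just r → r ∈ prefB b
    partnerListed' {r} {b} e = [ partnerListed , id ] (newPartner-listed s b e)

    preserved : Inv s'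
    preserved = record
      { partnerᴿ = partnerᴿ' ; partnerᴮ = partnerᴮ' ; proposalTo = proposalTo' ; proposerFree = proposerFree'
      ; ascending = ascending' ; partnerDominates = partnerDominates' ; proposeeDominates = proposeeDominates'
      ; blocked = blocked' ; partnerListed = partnerListed' }

  reachable-Inv : ∀ i → Inv (run i)
  reachable-Inv zero    = initial-Inv
  reachable-Inv (suc i) = Round.preserved (run i) (reachable-Inv i)

module Stability {nR nB} (G : PrefGraph nR nB) where
  open PrefGraph G
  open Algorithm G
  open Invariants G
  open import Data.List.Membership.DecPropositional (_≟_ {nB}) using (_∈?_)

  module _ {s : State} (I : Inv s) {r : Fin nR} {b : Fin nB} where
    open Inv I

    still-candidate : b ∈ prefR r →
      (∀ r' → ¬ pR s r' ≡ just b) ⊎ (∃ λ r' → pR s r' ≡ just b × Prefers (prefB b) r r') → b ∈ C s r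
    still-candidate b∈ blueSide with b ∈? C s r
    ... | yes b∈C = b∈C
    ... | no b∉ with blocked b∈ b∉ | blueSide
    ...   | r' , p , _  | inj₁ single = contradiction (partnerᴮ p) (single r')
    ...   | r' , p , lt | inj₂ (r'' , m , r≻r'')
      with refl ← just-injective (trans (sym p) (partnerᴿ m)) =
      contradiction (Prefers⇒rank< (uniqueB b) r≻r'') (<-asym lt)

    unmatched : b ∈ C s r →
      (∀ b' → ¬ pR s r ≡ just b') ⊎ (∃ λ b' → pR s r ≡ just b' × Prefers (prefR r) b b') → pR s r ≡ nothing
    unmatched _   (inj₁ single)        = no-just⇒nothing single
    unmatched b∈C (inj₂ (_ , m , b≻b')) =
      contradiction (All.lookup (partnerDominates m) b∈C) (<⇒≱ (Prefers⇒rank< (uniqueR r) b≻b'))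

  unstable-edge : ∀ i {r b} → Unstable i r b → b ∈ C (run i) r × pR (run i) r ≡ nothing
  unstable-edge i {r} {b} (b∈ , _ , redSide , blueSide) = b∈C , unmatched I b∈C redSide
    where
    I : Inv (run i)
    I = reachable-Inv i
    b∈C : b ∈ C (run i) r
    b∈C = still-candidate I b∈ blueSide

lemma1 : ∀ {nR nB} (G : PrefGraph nR nB) (i : ℕ) (r : Fin nR) (b : Fin nB) →
    let open Algorithm G in
    Unstable (suc i) r b → (b ∈ C (run (suc i)) r) × (pR (run (suc i)) r ≡ nothing)
lemma1 G i r b = Stability.unstable-edge G (suc i)
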